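{- Let $\omega\ge 3$ and let $\Gamma$ be a connected graph such that $C_\omega(L(\Gamma))\cong\Gamma$. Then $\Delta(\Gamma)\le\omega$, where $\Delta(\Gamma)$ is the maximum degree of $\Gamma$.
   Context: All graphs are finite, without loops or parallel edges. The line graph $L(\Gamma)$ has the edges of $\Gamma$ as vertices, two edges being adjacent iff they share an endpoint. For a graph $H$, the $\omega$-clique graph $C_\omega(H)$ is the graph whose vertices are the cliques of order $\omega$ of $H$ (sets of $\omega$ pairwise adjacent vertices), two distinct such cliques being adjacent iff they have nonempty intersection. -}

module Defs where

open import Data.Nat using (ℕ; _≤_)
open import Data.Fin using (Fin; _<_)
open import Data.Bool using (Bool; true; false; T; if_then_else_)
open import Data.Product using (Σ; ∃; _×_; _,_; proj₁; proj₂)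
open import Data.Sum using (_⊎_)
open import Data.List using (map; allFin)
open import Data.Nat.ListAction using (sum)
open import Relation.Binary.PropositionalEquality using (_≡_; _≢_)
open import Relation.Nullary using (¬_)
open import Relation.Binary.Construct.Closure.ReflexiveTransitive using (Star)
open import Function.Bundles using (_⇔_)

record FinGraph : Set where
  field
    n       : ℕ
    adj     : Fin n → Fin n → Bool
    adj-sym : ∀ i j → adj i j ≡ adj j i
    adj-irr : ∀ i → adj i i ≡ false
open FinGraph public

record Graph : Set₁ where
  field
    V   : Set
    Adj : V → V → Set
open Graph public

-- An edge {i , j} of Γ, represented uniquely as (i , j) with i < j.
Edge : FinGraph → Set
Edge Γ = Σ (Fin (n Γ) × Fin (n Γ)) λ p → (proj₁ p < proj₂ p) × T (adj Γ (proj₁ p) (proj₂ p))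

ShareEnd : (Γ : FinGraph) → Edge Γ → Edge Γ → Set
ShareEnd Γ ((a , b) , _) ((c , d) , _) = (a ≡ c) ⊎ (a ≡ d) ⊎ (b ≡ c) ⊎ (b ≡ d)

L : FinGraph → Graph
L Γ = record { V = Edge Γ ; Adj = λ e f → (e ≢ f) × ShareEnd Γ e f }

Clique : ℕ → Graph → Set
Clique ω H = Σ (Fin ω → V H) λ c →
  (∀ i j → c i ≡ c j → i ≡ j) × (∀ i j → i ≢ j → Adj H (c i) (c j))

_∈C_ : ∀ {ω H} → V H → Clique ω H → Set
_∈C_ {ω} v (c , _) = ∃ λ (i : Fin ω) → c i ≡ v

SameClique : ∀ {ω H} → Clique ω H → Clique ω H → Set
SameClique {ω} {H} K K' = ∀ (v : V H) → (_∈C_ {ω} {H} v K) ⇔ (_∈C_ {ω} {H} v K')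

CAdj : ∀ {ω H} → Clique ω H → Clique ω H → Set
CAdj {ω} {H} K K' = ¬ SameClique {ω} {H} K K'
  × (∃ λ (v : V H) → (_∈C_ {ω} {H} v K) × (_∈C_ {ω} {H} v K'))

-- The vertices of C_ω(H) are cliques up to SameClique, so an
-- isomorphism is a map φ from listed cliques to Fin n which identifies exactly
-- the equal cliques, is surjective, and preserves and reflects adjacency.
CliqueGraphIso : ℕ → Graph → FinGraph → Set
CliqueGraphIso ω H Γ = Σ (Clique ω H → Fin (n Γ)) λ φ →
    (∀ K K' → (φ K ≡ φ K') ⇔ SameClique {ω} {H} K K')
  × (∀ v → ∃ λ K → φ K ≡ v)
  × (∀ K K' → T (adj Γ (φ K) (φ K')) ⇔ CAdj {ω} {H} K K')

Connected : FinGraph → Set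
Connected Γ = ∀ u v → Star (λ x y → T (adj Γ x y)) u v

degree : (Γ : FinGraph) → Fin (n Γ) → ℕ
degree Γ v = sum (map (λ j → if adj Γ v j then 1 else 0) (allFin (n Γ)))

MaxDegree≤ : FinGraph → ℕ → Set
MaxDegree≤ Γ k = ∀ v → degree Γ v ≤ k

{-# OPTIONS --safe #-}
-- Write ω = 2 + k.  A family of ω distinct edges at a vertex x is an ω-clique of L(Γ), a star
-- at x, and under φ : C_ω(L(Γ)) ≅ Γ stars sharing an edge become adjacent vertices.  Let v have
-- maximum degree D > ω.
-- If D ≥ ω + 2, a star K₀ at v meets the ω (D − ω) stars obtained by exchanging one of its edges
-- for another edge at v, so φ K₀ has degree at least ω (D − ω) > D.
-- If D = ω + 1, no vertex y of degree ω + 1 has two distinct neighbours a, b of degree ≥ ω: a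
-- star S at y through ya and yb meets a star at a through ya, a star at b through yb and the ω
-- other stars at y, so φ S has degree ≥ ω + 2.  The ω + 1 stars at v omitting one edge each
-- are pairwise adjacent; if some other clique met one of them, its image would have degree
-- ω + 1 and two neighbours of degree ≥ ω among the others.  So by connectedness their images
-- exhaust Γ, which is too few vertices for v and its ω + 1 neighbours.
module Submission where

open import Defs
open import Data.Nat as ℕ using (ℕ; zero; suc; _+_; _*_; _∸_; _≤_; _<_; s≤s)
open import Data.Nat.Properties as ℕ using (≤-trans; ≤-refl; ≤-antisym; <-irrefl; m≤m+n; m+[n∸m]≡n)
open import Data.Nat.Solver using (module +-*-Solver)
open import Data.Nat.ListAction using (sum)
import Data.List.Extrema.Nat as Extrema
open import Data.Fin as Fin using (Fin; zero; suc; punchIn; punchOut; inject≤; _↑ˡ_; _↑ʳ_; remQuot; combine; splitAt)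
open import Data.Fin.Properties as Fin
  using (_≟_; any?; <-cmp; injective⇒≤; punchIn-injective; punchInᵢ≢i; punchIn-punchOut;
         inject≤-injective; ↑ˡ-injective; ↑ʳ-injective)
open import Data.Bool using (Bool; true; false; T; if_then_else_)
open import Data.Bool.Properties using (T-irrelevant)
open import Data.Empty using (⊥; ⊥-elim)
open import Data.Product using (∃; _×_; _,_; proj₁; proj₂; uncurry)
open import Data.Sum using (_⊎_; inj₁; inj₂; swap)
open import Data.List using (List; []; _∷_; map; allFin; filterᵇ; length; lookup)
open import Data.List.Membership.Propositional.Properties using (∈-lookup; ∈-filter⁺; ∈-filter⁻; ∈-allFin)
open import Data.List.Relation.Unary.All as All using ()
open import Data.List.Relation.Unary.Any as Any using (index)
open import Data.List.Relation.Unary.Any.Properties using (lookup-index)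
open import Data.List.Relation.Unary.Unique.Propositional using (Unique; _∷_)
open import Data.List.Relation.Unary.Unique.Propositional.Properties using (filter⁺; allFin⁺)
open import Data.Vec.Functional as Vector using ()
open import Function.Base using (_∘_; id)
open import Function.Bundles using (Equivalence)
open import Function.Definitions using (Injective)
open import Relation.Binary.Definitions using (tri<; tri≈; tri>)
open import Relation.Binary.PropositionalEquality
open import Relation.Binary.Construct.Closure.ReflexiveTransitive using (fold)
open import Relation.Nullary using (¬_; yes; no)
open import Relation.Nullary.Decidable using (decidable-stable; T?)

lookup-injective : ∀ {A : Set} {xs : List A} → Unique xs → Injective _≡_ _≡_ (lookup xs)
lookup-injective (x∉xs ∷ _)   {zero}  {zero}  _  = refl
lookup-injective (x∉xs ∷ _)   {zero}  {suc j} eq = ⊥-elim (All.lookup x∉xs (∈-lookup j) eq)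
lookup-injective (x∉xs ∷ _)   {suc i} {zero}  eq = ⊥-elim (All.lookup x∉xs (∈-lookup i) (sym eq))
lookup-injective (_ ∷ xs-uniq) {suc i} {suc j} eq = cong suc (lookup-injective xs-uniq eq)

length-filterᵇ : ∀ {A : Set} (b : A → Bool) xs →
  length (filterᵇ b xs) ≡ sum (map (λ x → if b x then 1 else 0) xs)
length-filterᵇ b []       = refl
length-filterᵇ b (x ∷ xs) with b x
... | true  = cong suc (length-filterᵇ b xs)
... | false = length-filterᵇ b xs

record Family {A : Set} (P : A → Set) (k : ℕ) : Set where
  field
    at           : Fin k → A
    at-injective : Injective _≡_ _≡_ at
    at-sound     : ∀ i → P (at i)

restrict : ∀ {A : Set} {P : A → Set} {j k} → Family P k →
  (g : Fin j → Fin k) → Injective _≡_ _≡_ g → Family P j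
restrict F g g-injective = record
  { at = at ∘ g ; at-injective = g-injective ∘ at-injective ; at-sound = at-sound ∘ g }
  where open Family F

record Enumeration {A : Set} (P : A → Set) (k : ℕ) : Set where
  field
    family   : Family P k
  open Family family public
  field
    complete : ∀ {a} → P a → ∃ λ i → at i ≡ a

family-size≤ : ∀ {A : Set} {P : A → Set} {j k} → Family P j → Enumeration P k → j ≤ k
family-size≤ F E = injective⇒≤ (λ {i} {i'} eq → F.at-injective (begin
    F.at i                          ≡⟨ proj₂ (E.complete (F.at-sound i)) ⟨
    E.at (index-of i)               ≡⟨ cong E.at eq ⟩
    E.at (index-of i')              ≡⟨ proj₂ (E.complete (F.at-sound i')) ⟩
    F.at i'                         ∎))
  where
  module F = Family F
  module E = Enumeration E
  open ≡-Reasoning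
  index-of = λ i → proj₁ (E.complete (F.at-sound i))

filterᵇ-enumeration : ∀ {n} (b : Fin n → Bool) → Enumeration (T ∘ b) (length (filterᵇ b (allFin n)))
filterᵇ-enumeration {n} b = record
  { family   = record
    { at           = lookup xs
    ; at-injective = lookup-injective (filter⁺ (T? ∘ b) (allFin⁺ n))
    ; at-sound     = λ i → proj₂ (∈-filter⁻ (T? ∘ b) {xs = allFin n} (∈-lookup i)) }
  ; complete = λ {a} ba → let a∈xs = ∈-filter⁺ (T? ∘ b) (∈-allFin a) ba in
      index a∈xs , sym (lookup-index a∈xs) }
  where
  xs = filterᵇ b (allFin n)

through : ∀ {k d} → k ≤ d → Fin (suc d) → Fin (suc k) → Fin (suc d)
through k≤d i zero    = i
through k≤d i (suc r) = punchIn i (inject≤ r k≤d)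

through-injective : ∀ {k d} (k≤d : k ≤ d) i → Injective _≡_ _≡_ (through k≤d i)
through-injective k≤d i {zero}  {zero}  _  = refl
through-injective k≤d i {zero}  {suc r} eq = ⊥-elim (punchInᵢ≢i i _ (sym eq))
through-injective k≤d i {suc r} {zero}  eq = ⊥-elim (punchInᵢ≢i i _ eq)
through-injective k≤d i {suc r} {suc s} eq =
  cong suc (inject≤-injective k≤d k≤d r s (punchIn-injective i _ _ eq))

avoid₂ : ∀ {k} (a b : Fin (3 + k)) → ∃ λ c → c ≢ a × c ≢ b
avoid₂ zero          zero          = suc zero , (λ ()) , (λ ())
avoid₂ zero          (suc zero)    = suc (suc zero) , (λ ()) , (λ ())
avoid₂ zero          (suc (suc _)) = suc zero , (λ ()) , (λ ())
avoid₂ (suc zero)    zero          = suc (suc zero) , (λ ()) , (λ ())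
avoid₂ (suc (suc _)) zero          = suc zero , (λ ()) , (λ ())
avoid₂ (suc _)       (suc _)       = zero , (λ ()) , (λ ())

distinct⇒injective : ∀ {A : Set} {k} (R : A → A → Set) {f : Fin k → A} →
  (∀ {i j} → i ≢ j → ¬ R (f i) (f j)) → Injective _≡_ R f
distinct⇒injective R distinct {i} {j} r = decidable-stable (i ≟ j) (λ i≢j → distinct i≢j r)

↑ˡ≢↑ʳ : ∀ {m n} {i : Fin m} {j : Fin n} → i ↑ˡ n ≢ m ↑ʳ j
↑ˡ≢↑ʳ {m} {n} {i} {j} eq = inj₁≢inj₂ (begin
  inj₁ i             ≡⟨ Fin.splitAt-↑ˡ m i n ⟨
  splitAt m (i ↑ˡ n) ≡⟨ cong (splitAt m) eq ⟩
  splitAt m (m ↑ʳ j) ≡⟨ Fin.splitAt-↑ʳ m n j ⟩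
  inj₂ j             ∎)
  where
  open ≡-Reasoning
  inj₁≢inj₂ : inj₁ i ≢ inj₂ j
  inj₁≢inj₂ ()

remQuot-injective : ∀ {m} n → Injective _≡_ _≡_ (remQuot {m} n)
remQuot-injective {m} n {i} {j} eq = begin
  i                                 ≡⟨ Fin.combine-remQuot {m} n i ⟨
  uncurry combine (remQuot {m} n i) ≡⟨ cong (uncurry combine) eq ⟩
  uncurry combine (remQuot {m} n j) ≡⟨ Fin.combine-remQuot {m} n j ⟩
  j                                 ∎
  where open ≡-Reasoning

m+n<m*n : ∀ {m n} → 3 ≤ m → 2 ≤ n → m + n < m * n
m+n<m*n {suc (suc (suc a))} {suc (suc b)} (s≤s (s≤s (s≤s _))) (s≤s (s≤s _)) =
  subst (suc (3 + a + (2 + b)) ≤_) (sym expand) (m≤m+n _ _)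
  where
  open +-*-Solver
  expand : (3 + a) * (2 + b) ≡ suc (3 + a + (2 + b)) + (a + 2 * b + a * b)
  expand = solve 2 (λ a b → (con 3 :+ a) :* (con 2 :+ b) :=
                            con 1 :+ (con 3 :+ a :+ (con 2 :+ b)) :+ (a :+ con 2 :* b :+ a :* b)) refl a b

module FinGraphProperties (Γ : FinGraph) where

  Vertex : Set
  Vertex = Fin (n Γ)

  Adjacent : Vertex → Vertex → Set
  Adjacent x y = T (adj Γ x y)

  Adjacent-sym : ∀ {x y} → Adjacent x y → Adjacent y x
  Adjacent-sym {x} {y} = subst T (adj-sym Γ x y)

  Adjacent-irreflexive : ∀ {x y} → Adjacent x y → x ≢ y
  Adjacent-irreflexive {x} p refl = subst T (adj-irr Γ x) p

  neighbours : ∀ x → Enumeration (Adjacent x) (degree Γ x)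
  neighbours x = subst (Enumeration (Adjacent x)) (length-filterᵇ (adj Γ x) (allFin (n Γ)))
                       (filterᵇ-enumeration (adj Γ x))

  ≤-degree : ∀ {x k} → Family (Adjacent x) k → k ≤ degree Γ x
  ≤-degree F = family-size≤ F (neighbours _)

  degree<n : ∀ x → degree Γ x < n Γ
  degree<n x = injective⇒≤ {f = x Vector.∷ at} x∷at-injective
    where
    open Enumeration (neighbours x)
    x∷at-injective : Injective _≡_ _≡_ (x Vector.∷ at)
    x∷at-injective {zero}  {zero}  _  = refl
    x∷at-injective {zero}  {suc j} eq = ⊥-elim (Adjacent-irreflexive (at-sound j) eq)
    x∷at-injective {suc i} {zero}  eq = ⊥-elim (Adjacent-irreflexive (at-sound i) (sym eq))
    x∷at-injective {suc i} {suc j} eq = cong suc (at-injective eq)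

  heaviest : Vertex → Vertex
  heaviest v = Extrema.argmax (degree Γ) v (allFin (n Γ))

  degree≤heaviest : ∀ v u → degree Γ u ≤ degree Γ (heaviest v)
  degree≤heaviest v u =
    Extrema.v≤f[argmax]⁺ v (allFin (n Γ)) (inj₂ (Any.map (λ { refl → ≤-refl }) (∈-allFin u)))

  connected-invariant : Connected Γ → (P : Vertex → Set) →
    (∀ {a b} → Adjacent a b → P a → P b) → ∀ {u} → P u → ∀ z → P z
  connected-invariant connected P step {u} Pu z =
    fold (λ a b → P a → P b) (λ a~b Pb→Pc → Pb→Pc ∘ step a~b) id (connected u z) Pu

  _∈ₑ_ : Vertex → Edge Γ → Set
  z ∈ₑ ((a , b) , _) = z ≡ a ⊎ z ≡ b

  edge : ∀ {x u} → Adjacent x u → Edge Γ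
  edge {x} {u} p with <-cmp x u
  ... | tri< x<u _ _ = (x , u) , x<u , p
  ... | tri≈ _ x≡u _ = ⊥-elim (Adjacent-irreflexive p x≡u)
  ... | tri> _ _ u<x = (u , x) , u<x , Adjacent-sym p

  ∈ₑ-edgeˡ : ∀ {x u} (p : Adjacent x u) → x ∈ₑ edge p
  ∈ₑ-edgeˡ {x} {u} p with <-cmp x u
  ... | tri< _ _ _   = inj₁ refl
  ... | tri≈ _ x≡u _ = ⊥-elim (Adjacent-irreflexive p x≡u)
  ... | tri> _ _ _   = inj₂ refl

  ∈ₑ-edgeʳ : ∀ {x u} (p : Adjacent x u) → u ∈ₑ edge p
  ∈ₑ-edgeʳ {x} {u} p with <-cmp x u
  ... | tri< _ _ _   = inj₂ refl
  ... | tri≈ _ x≡u _ = ⊥-elim (Adjacent-irreflexive p x≡u)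
  ... | tri> _ _ _   = inj₁ refl

  ∈ₑ-edge⁻ : ∀ {x u z} (p : Adjacent x u) → z ∈ₑ edge p → z ≡ x ⊎ z ≡ u
  ∈ₑ-edge⁻ {x} {u} p z∈e with <-cmp x u
  ... | tri< _ _ _   = z∈e
  ... | tri≈ _ x≡u _ = ⊥-elim (Adjacent-irreflexive p x≡u)
  ... | tri> _ _ _   = swap z∈e

  edge-injectiveʳ : ∀ {x u u'} (p : Adjacent x u) (p' : Adjacent x u') → edge p ≡ edge p' → u ≡ u'
  edge-injectiveʳ p p' eq with ∈ₑ-edge⁻ p (subst (_ ∈ₑ_) (sym eq) (∈ₑ-edgeʳ p'))
  ... | inj₁ u'≡x = ⊥-elim (Adjacent-irreflexive p' (sym u'≡x))
  ... | inj₂ u'≡u = sym u'≡u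

  edge-irrelevant : ∀ {a b} (l l' : a Fin.< b) (p p' : Adjacent a b) →
    _≡_ {A = Edge Γ} ((a , b) , l , p) ((a , b) , l' , p')
  edge-irrelevant l l' p p' = cong₂ (λ l p → (_ , _) , l , p) (Fin.<-irrelevant l l') (T-irrelevant p p')

  edge-unique : ∀ {x y} (e e' : Edge Γ) → x ≢ y → x ∈ₑ e → y ∈ₑ e → x ∈ₑ e' → y ∈ₑ e' → e ≡ e'
  edge-unique ((a , b) , a<b , _) ((c , d) , c<d , _) x≢y x∈e y∈e x∈e' y∈e'
    with x∈e | y∈e | x∈e' | y∈e'
  ... | inj₁ refl | inj₁ refl | _ | _ = ⊥-elim (x≢y refl)
  ... | inj₂ refl | inj₂ refl | _ | _ = ⊥-elim (x≢y refl)
  ... | _ | _ | inj₁ refl | inj₁ refl = ⊥-elim (x≢y refl)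
  ... | _ | _ | inj₂ refl | inj₂ refl = ⊥-elim (x≢y refl)
  ... | inj₁ refl | inj₂ refl | inj₁ refl | inj₂ refl = edge-irrelevant _ _ _ _
  ... | inj₂ refl | inj₁ refl | inj₂ refl | inj₁ refl = edge-irrelevant _ _ _ _
  ... | inj₁ refl | inj₂ refl | inj₂ refl | inj₁ refl = ⊥-elim (Fin.<-asym a<b c<d)
  ... | inj₂ refl | inj₁ refl | inj₁ refl | inj₂ refl = ⊥-elim (Fin.<-asym a<b c<d)

  share-end : ∀ {z} (e e' : Edge Γ) → z ∈ₑ e → z ∈ₑ e' → ShareEnd Γ e e'
  share-end _ _ (inj₁ refl) (inj₁ refl) = inj₁ refl
  share-end _ _ (inj₁ refl) (inj₂ refl) = inj₂ (inj₁ refl)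
  share-end _ _ (inj₂ refl) (inj₁ refl) = inj₂ (inj₂ (inj₁ refl))
  share-end _ _ (inj₂ refl) (inj₂ refl) = inj₂ (inj₂ (inj₂ refl))

module Cliques (ω : ℕ) (H : Graph) where

  _∈ᴷ_ : V H → Clique ω H → Set
  _∈ᴷ_ = _∈C_ {ω} {H}

  _≈ᴷ_ : Clique ω H → Clique ω H → Set
  _≈ᴷ_ = SameClique {ω} {H}

  _~ᴷ_ : Clique ω H → Clique ω H → Set
  _~ᴷ_ = CAdj {ω} {H}

  distinguish : ∀ {v K K'} → v ∈ᴷ K → ¬ v ∈ᴷ K' → ¬ K ≈ᴷ K'
  distinguish v∈K v∉K' K≈K' = v∉K' (Equivalence.to (K≈K' _) v∈K)

module Isomorphism {ω H Γ} (iso : CliqueGraphIso ω H Γ) where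
  open Cliques ω H
  open FinGraphProperties Γ using (Vertex; Adjacent; ≤-degree)

  φ : Clique ω H → Vertex
  φ = proj₁ iso

  φ-≈ᴷ : ∀ {K K'} → φ K ≡ φ K' → K ≈ᴷ K'
  φ-≈ᴷ {K} {K'} = Equivalence.to (proj₁ (proj₂ iso) K K')

  ≈ᴷ-φ : ∀ {K K'} → K ≈ᴷ K' → φ K ≡ φ K'
  ≈ᴷ-φ {K} {K'} = Equivalence.from (proj₁ (proj₂ iso) K K')

  φ-surjective : ∀ u → ∃ λ K → φ K ≡ u
  φ-surjective = proj₁ (proj₂ (proj₂ iso))

  φ-adjacent : ∀ {K K'} → K ~ᴷ K' → Adjacent (φ K) (φ K')
  φ-adjacent {K} {K'} = Equivalence.from (proj₂ (proj₂ (proj₂ iso)) K K')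

  adjacent-φ : ∀ {K K'} → Adjacent (φ K) (φ K') → K ~ᴷ K'
  adjacent-φ {K} {K'} = Equivalence.to (proj₂ (proj₂ (proj₂ iso)) K K')

  ≤-degree-φ : ∀ {j K} (F : Fin j → Clique ω H) → Injective _≡_ _≈ᴷ_ F →
    (∀ i → K ~ᴷ F i) → j ≤ degree Γ (φ K)
  ≤-degree-φ F F-injective K~F = ≤-degree (record
    { at = φ ∘ F ; at-injective = F-injective ∘ φ-≈ᴷ ; at-sound = φ-adjacent ∘ K~F })

module Stars (Γ : FinGraph) (k : ℕ) where
  open FinGraphProperties Γ
  open Cliques (2 + k) (L Γ) public

  Centred : Vertex → Clique (2 + k) (L Γ) → Set
  Centred x K = ∀ {e} → e ∈ᴷ K → x ∈ₑ e

  Links : Vertex → Vertex → Clique (2 + k) (L Γ) → Set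
  Links x y K = ∃ λ e → e ∈ᴷ K × x ∈ₑ e × y ∈ₑ e

  centre-unique : ∀ {x y} (K K' : Clique (2 + k) (L Γ)) → x ≢ y → Centred x K → Centred y K' → ¬ K ≈ᴷ K'
  centre-unique (c , c-injective , _) K' x≢y x∈K y∈K' K≈K' = 0≢1 (c-injective zero (suc zero) c₀≡c₁)
    where
    c∈K' : ∀ i → c i ∈ᴷ K'
    c∈K' i = Equivalence.to (K≈K' (c i)) (i , refl)
    c₀≡c₁ : c zero ≡ c (suc zero)
    c₀≡c₁ = edge-unique (c zero) (c (suc zero)) x≢y (x∈K (zero , refl)) (y∈K' (c∈K' zero))
                              (x∈K (suc zero , refl)) (y∈K' (c∈K' (suc zero)))
    0≢1 : zero ≢ suc zero
    0≢1 ()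

  common-edge : ∀ {x y} (K K' : Clique (2 + k) (L Γ)) → x ≢ y → Links x y K → Links x y K' →
    ∃ λ e → e ∈ᴷ K × e ∈ᴷ K'
  common-edge K K' x≢y (e , e∈K , x∈e , y∈e) (e' , e'∈K' , x∈e' , y∈e') =
    e , e∈K , subst (_∈ᴷ K') (edge-unique e' e x≢y x∈e' y∈e' x∈e y∈e) e'∈K'

  star : ∀ {x} → Family (Adjacent x) (2 + k) → Clique (2 + k) (L Γ)
  star F = (λ i → edge (at-sound i))
         , (λ i j eq → at-injective (edge-injectiveʳ (at-sound i) (at-sound j) eq))
         , (λ i j i≢j → (λ eq → i≢j (at-injective (edge-injectiveʳ (at-sound i) (at-sound j) eq)))
                      , share-end (edge (at-sound i)) (edge (at-sound j))
                                  (∈ₑ-edgeˡ (at-sound i)) (∈ₑ-edgeˡ (at-sound j)))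
    where open Family F

  star-centred : ∀ {x} (F : Family (Adjacent x) (2 + k)) → Centred x (star F)
  star-centred F (i , refl) = ∈ₑ-edgeˡ (Family.at-sound F i)

  edge∈star⁻ : ∀ {x u} {p : Adjacent x u} (F : Family (Adjacent x) (2 + k)) →
    edge p ∈ᴷ star F → ∃ λ i → Family.at F i ≡ u
  edge∈star⁻ {p = p} F (i , eq) = i , edge-injectiveʳ (Family.at-sound F i) p eq

  star-through : ∀ {y a} → Adjacent y a → 2 + k ≤ degree Γ a →
    ∃ λ K → Centred a K × Links y a K
  star-through {y} {a} y~a 2+k≤deg with degree Γ a | neighbours a
  ... | suc d | Na = star F , star-centred F , edge (at-sound zero) , (zero , refl) ,
      subst (λ z → z ∈ₑ (edge (at-sound zero))) (proj₂ y∈Na) (∈ₑ-edgeʳ (at-sound zero)) ,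
      ∈ₑ-edgeˡ (at-sound zero)
    where
    y∈Na = Enumeration.complete Na (Adjacent-sym y~a)
    1+k≤d = ℕ.≤-pred 2+k≤deg
    F = restrict (Enumeration.family Na) (through 1+k≤d (proj₁ y∈Na)) (through-injective 1+k≤d _)
    open Family F

  module Omit {x} (F : Family (Adjacent x) (3 + k)) where
    open Family F

    without : Fin (3 + k) → Family (Adjacent x) (2 + k)
    without t = restrict F (punchIn t) (punchIn-injective t _ _)

    omit : Fin (3 + k) → Clique (2 + k) (L Γ)
    omit = star ∘ without

    omit-centred : ∀ t → Centred x (omit t)
    omit-centred t = star-centred (without t)

    ∈-omit : ∀ {s t} → s ≢ t → edge (at-sound s) ∈ᴷ omit t
    ∈-omit s≢t = punchOut (s≢t ∘ sym) , cong (λ s → edge (at-sound s)) (punchIn-punchOut _)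

    ∉-omit : ∀ t → ¬ edge (at-sound t) ∈ᴷ omit t
    ∉-omit t t∈omit-t with edge∈star⁻ {p = at-sound t} (without t) t∈omit-t
    ... | r , eq = punchInᵢ≢i t r (at-injective eq)

    omit-injective : Injective _≡_ _≈ᴷ_ omit
    omit-injective = distinct⇒injective _≈ᴷ_ {omit} λ {t} {t'} t≢t' →
      distinguish {K = omit t} {omit t'} (∈-omit (t≢t' ∘ sym)) (∉-omit t')

    omit-adjacent : ∀ {t t'} → t ≢ t' → omit t ~ᴷ omit t'
    omit-adjacent {t} {t'} t≢t' with avoid₂ t t'
    ... | s , s≢t , s≢t' = t≢t' ∘ omit-injective , edge (at-sound s) , ∈-omit s≢t , ∈-omit s≢t'

    omit-links : ∀ {s t} → s ≢ t → Links x (at s) (omit t)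
    omit-links {s} s≢t = edge (at-sound s) , ∈-omit s≢t , ∈ₑ-edgeˡ (at-sound s) , ∈ₑ-edgeʳ (at-sound s)

    others : Fin (3 + k) → Fin (2 + k) → Clique (2 + k) (L Γ)
    others t = omit ∘ punchIn t

    others-injective : ∀ t → Injective _≡_ _≈ᴷ_ (others t)
    others-injective t = punchIn-injective t _ _ ∘ omit-injective

    omit~others : ∀ t r → omit t ~ᴷ others t r
    omit~others t r = omit-adjacent (punchInᵢ≢i t r ∘ sym)

module _ (Γ : FinGraph) (k : ℕ) (iso : CliqueGraphIso (2 + k) (L Γ) Γ) where
  open FinGraphProperties Γ
  open Stars Γ k
  open Isomorphism {H = L Γ} {Γ} iso

  omit-degree : ∀ {x} (F : Family (Adjacent x) (3 + k)) t → 2 + k ≤ degree Γ (φ (Omit.omit F t))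
  omit-degree F t = ≤-degree-φ (others t) (others-injective t) (omit~others t)
    where open Omit F

  ¬two-heavy-neighbours : (∀ u → degree Γ u ≤ 3 + k) → ∀ {y a b} → degree Γ y ≡ 3 + k →
    Adjacent y a → Adjacent y b → a ≢ b → 2 + k ≤ degree Γ a → 2 + k ≤ degree Γ b → ⊥
  ¬two-heavy-neighbours max {y} {a} {b} deg-y y~a y~b a≢b heavy-a heavy-b =
    <-irrefl refl (≤-trans (≤-degree-φ F F-injective S~F) (max (φ S)))
    where
    open Enumeration (subst (Enumeration (Adjacent y)) deg-y (neighbours y))
    open Omit family
    y≢a = Adjacent-irreflexive y~a
    y≢b = Adjacent-irreflexive y~b
    p = proj₁ (complete y~a)
    q = proj₁ (complete y~b)
    t = proj₁ (avoid₂ p q)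
    t≢p = proj₁ (proj₂ (avoid₂ p q))
    t≢q = proj₂ (proj₂ (avoid₂ p q))
    S = omit t
    links-S : ∀ {s z} → s ≢ t → at s ≡ z → Links y z S
    links-S s≢t refl = omit-links s≢t
    KA = proj₁ (star-through y~a heavy-a)
    KB = proj₁ (star-through y~b heavy-b)
    KA-centred = proj₁ (proj₂ (star-through y~a heavy-a))
    KB-centred = proj₁ (proj₂ (star-through y~b heavy-b))
    KA-links = proj₂ (proj₂ (star-through y~a heavy-a))
    KB-links = proj₂ (proj₂ (star-through y~b heavy-b))
    F : Fin (4 + k) → Clique (2 + k) (L Γ)
    F = KA Vector.∷ KB Vector.∷ others t
    F-distinct : ∀ {i j} → i ≢ j → ¬ F i ≈ᴷ F j
    F-distinct {zero}        {zero}         0≢0  = ⊥-elim (0≢0 refl)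
    F-distinct {zero}        {suc zero}     _    = centre-unique KA KB a≢b KA-centred KB-centred
    F-distinct {zero}        {suc (suc r)}  _    =
      centre-unique KA (others t r) (y≢a ∘ sym) KA-centred (omit-centred _)
    F-distinct {suc zero}    {zero}         _    = centre-unique KB KA (a≢b ∘ sym) KB-centred KA-centred
    F-distinct {suc zero}    {suc zero}     1≢1  = ⊥-elim (1≢1 refl)
    F-distinct {suc zero}    {suc (suc r)}  _    =
      centre-unique KB (others t r) (y≢b ∘ sym) KB-centred (omit-centred _)
    F-distinct {suc (suc r)} {zero}         _    =
      centre-unique (others t r) KA y≢a (omit-centred _) KA-centred
    F-distinct {suc (suc r)} {suc zero}     _    =
      centre-unique (others t r) KB y≢b (omit-centred _) KB-centred
    F-distinct {suc (suc r)} {suc (suc r')} r≢r' = r≢r' ∘ cong (λ r → suc (suc r)) ∘ others-injective t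
    F-injective : Injective _≡_ _≈ᴷ_ F
    F-injective = distinct⇒injective _≈ᴷ_ {F} F-distinct
    S~F : ∀ i → S ~ᴷ F i
    S~F zero = centre-unique S KA y≢a (omit-centred t) KA-centred ,
      common-edge S KA y≢a (links-S (t≢p ∘ sym) (proj₂ (complete y~a))) KA-links
    S~F (suc zero) = centre-unique S KB y≢b (omit-centred t) KB-centred ,
      common-edge S KB y≢b (links-S (t≢q ∘ sym) (proj₂ (complete y~b))) KB-links
    S~F (suc (suc r)) = omit~others t r

  module Δ≡3+k (max : ∀ u → degree Γ u ≤ 3 + k) {v} (deg-v : degree Γ v ≡ 3 + k) where
    open Enumeration (subst (Enumeration (Adjacent v)) deg-v (neighbours v))
    open Omit family

    omit-closed : ∀ t K → omit t ~ᴷ K → ∃ λ t' → φ (omit t') ≡ φ K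
    omit-closed t K t~K with any? (λ t' → φ (omit t') ≟ φ K)
    ... | yes found = found
    ... | no K-new  = ⊥-elim (¬two-heavy-neighbours max (≤-antisym (max _) 3+k≤deg)
                        (φ-adjacent (omit~others t zero)) (φ-adjacent (omit~others t (suc zero)))
                        ((λ ()) ∘ others-injective t ∘ φ-≈ᴷ) (omit-degree family _) (omit-degree family _))
      where
      G : Fin (3 + k) → Clique (2 + k) (L Γ)
      G = K Vector.∷ others t
      G-distinct : ∀ {i j} → i ≢ j → ¬ G i ≈ᴷ G j
      G-distinct {zero}  {zero}   0≢0  = ⊥-elim (0≢0 refl)
      G-distinct {zero}  {suc r}  _    = λ K≈ → K-new (punchIn t r , sym (≈ᴷ-φ K≈))
      G-distinct {suc r} {zero}   _    = λ ≈K → K-new (punchIn t r , ≈ᴷ-φ ≈K)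
      G-distinct {suc r} {suc r'} r≢r' = r≢r' ∘ cong suc ∘ others-injective t
      3+k≤deg : 3 + k ≤ degree Γ (φ (omit t))
      3+k≤deg = ≤-degree-φ G (distinct⇒injective _≈ᴷ_ {G} G-distinct)
                           λ { zero → t~K ; (suc r) → omit~others t r }

    omit-covers : Connected Γ → ∀ z → ∃ λ t → φ (omit t) ≡ z
    omit-covers connected =
      connected-invariant connected (λ z → ∃ λ t → φ (omit t) ≡ z) step (zero , refl)
      where
      step : ∀ {a b} → Adjacent a b → ∃ (λ t → φ (omit t) ≡ a) → ∃ λ t → φ (omit t) ≡ b
      step {b = b} a~b (t , refl) with φ-surjective b
      ... | K , refl = omit-closed t K (adjacent-φ a~b)

    disconnected : ¬ Connected Γ
    disconnected connected = <-irrefl refl (≤-trans (subst (_< n Γ) deg-v (degree<n v)) n≤3+k)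
      where
      cover = omit-covers connected
      n≤3+k : n Γ ≤ 3 + k
      n≤3+k = injective⇒≤ {f = proj₁ ∘ cover} λ {z} {z'} eq →
        trans (sym (proj₂ (cover z))) (trans (cong (φ ∘ omit) eq) (proj₂ (cover z')))

  replacement-degree : ∀ {x} m → Family (Adjacent x) (2 + k + m) → ∃ λ u → (2 + k) * m ≤ degree Γ u
  replacement-degree m F =
    φ K₀ , ≤-degree-φ (S ∘ remQuot m) (remQuot-injective m ∘ S-injective) (K₀~S ∘ remQuot m)
    where
    open Family F
    ω = 2 + k
    σ : Fin m → Fin (suc ω) → Fin (ω + m)
    σ j zero    = ω ↑ʳ j
    σ j (suc i) = i ↑ˡ m
    σ-ʳ : ∀ {j j' s} → σ j s ≡ ω ↑ʳ j' → j ≡ j'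
    σ-ʳ {s = zero}  eq = ↑ʳ-injective ω _ _ eq
    σ-ʳ {s = suc i} eq = ⊥-elim (↑ˡ≢↑ʳ eq)
    σ-injective : ∀ j → Injective _≡_ _≡_ (σ j)
    σ-injective j {zero}  {zero}  _  = refl
    σ-injective j {zero}  {suc i} eq = ⊥-elim (↑ˡ≢↑ʳ (sym eq))
    σ-injective j {suc i} {zero}  eq = ⊥-elim (↑ˡ≢↑ʳ eq)
    σ-injective j {suc i} {suc i'} eq = cong suc (↑ˡ-injective m i i' eq)
    module O j = Omit (restrict F (σ j) (σ-injective j))
    K₀ : Clique ω (L Γ)
    K₀ = star (restrict F (_↑ˡ m) (↑ˡ-injective m _ _))
    S : Fin ω × Fin m → Clique ω (L Γ)
    S (i , j) = O.omit j (suc i)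
    S-injective : Injective _≡_ _≈ᴷ_ S
    S-injective {i , j} {i' , j'} S≈S' with j ≟ j'
    ... | yes refl = cong (_, j) (Fin.suc-injective (O.omit-injective j S≈S'))
    ... | no j≢j'  =
      ⊥-elim (distinguish {K = S (i , j)} {S (i' , j')} (O.∈-omit j {zero} {suc i} (λ ())) ∉S' S≈S')
      where
      ∉S' : ¬ edge (at-sound (ω ↑ʳ j)) ∈ᴷ S (i' , j')
      ∉S' ∈S' with edge∈star⁻ (O.without j' (suc i')) ∈S'
      ... | r , eq = j≢j' (sym (σ-ʳ {s = punchIn (suc i') r} (at-injective eq)))
    -- Whatever j is, O.omit j zero has definitionally the same members as K₀.
    K₀~S : ∀ ij → K₀ ~ᴷ S ij
    K₀~S (i , j) = O.omit-adjacent j {zero} {suc i} (λ ())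

  ¬Δ>3+k : 3 ≤ 2 + k → ∀ {v} → (∀ u → degree Γ u ≤ degree Γ v) → 3 + k < degree Γ v → ⊥
  ¬Δ>3+k 3≤ω {v} max 3+k<deg = <-irrefl refl (begin-strict
    2 + k + m          <⟨ m+n<m*n 3≤ω 2≤m ⟩
    (2 + k) * m        ≤⟨ proj₂ (replacement-degree m family) ⟩
    degree Γ _         ≤⟨ max _ ⟩
    degree Γ v         ≡⟨ ω+m≡deg ⟨
    2 + k + m          ∎)
    where
    open ℕ.≤-Reasoning
    m = degree Γ v ∸ (2 + k)
    ω+m≡deg : 2 + k + m ≡ degree Γ v
    ω+m≡deg = m+[n∸m]≡n (≤-trans (ℕ.n≤1+n _) (ℕ.<⇒≤ 3+k<deg))
    2≤m : 2 ≤ m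
    2≤m = subst (_≤ m) (ℕ.m+n∸n≡m 2 k) (ℕ.∸-monoˡ-≤ (2 + k) 3+k<deg)
    family = subst (Family (Adjacent v)) (sym ω+m≡deg) (Enumeration.family (neighbours v))

  Δ≤2+k : 3 ≤ 2 + k → Connected Γ → ∀ {v} → (∀ u → degree Γ u ≤ degree Γ v) → degree Γ v ≤ 2 + k
  Δ≤2+k 3≤ω connected {v} max with ℕ.<-cmp (degree Γ v) (3 + k)
  ... | tri< deg<3+k _ _ = ℕ.≤-pred deg<3+k
  ... | tri≈ _ deg≡3+k _ =
    ⊥-elim (Δ≡3+k.disconnected (λ u → subst (degree Γ u ≤_) deg≡3+k (max u)) deg≡3+k connected)
  ... | tri> _ _ 3+k<deg = ⊥-elim (¬Δ>3+k 3≤ω max 3+k<deg)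

lemma2p6 : (ω : ℕ) → 3 ≤ ω → (Γ : FinGraph) → Connected Γ →
    CliqueGraphIso ω (L Γ) Γ → MaxDegree≤ Γ ω
lemma2p6 (suc (suc k)) 3≤ω@(s≤s (s≤s _)) Γ connected iso v =
  ≤-trans (degree≤heaviest v v) (Δ≤2+k Γ k iso 3≤ω connected (degree≤heaviest v))
  where open FinGraphProperties Γ using (degree≤heaviest)
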